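{- Let $R$ be a monotone transit function on a non-empty finite set $V$ satisfying (i): for all $x,y,u,v,p,q\in V$, if $\emptyset\neq R(x,y)\cap R(u,v)\subseteq R(p,q)$ and $R(p,q)\setminus(R(x,y)\cup R(u,v))\neq\emptyset$, then $R(x,y)\subseteq R(p,q)$ or $R(u,v)\subseteq R(p,q)$. Then $R$ satisfies (o'): for all $u,v\in V$ and $z\in R(u,v)$ there exist $p,q\in R(u,v)$ such that $R(p,z)\cup R(z,q)=R(u,v)$.
   Context: A transit function on $V$ is a map $R:V\times V\to 2^V$ with $u\in R(u,v)$, $R(u,v)=R(v,u)$, $R(u,u)=\{u\}$ for all $u,v\in V$; it is monotone if $p,q\in R(u,v)$ implies $R(p,q)\subseteq R(u,v)$. -}

module Defs where

open import Data.Nat using (ℕ)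
open import Data.Fin using (Fin)
open import Data.Fin.Subset using (Subset; _∈_; _⊆_; ⁅_⁆; _∩_; _∪_; _─_; Nonempty)
open import Data.Product using (_×_; ∃)
open import Data.Sum using (_⊎_)
open import Relation.Binary.PropositionalEquality using (_≡_)

record IsTransit {n : ℕ} (R : Fin n → Fin n → Subset n) : Set where
  field
    extensive : ∀ u v → u ∈ R u v
    symmetric : ∀ u v → R u v ≡ R v u
    idempotent : ∀ u → R u u ≡ ⁅ u ⁆

Monotone : {n : ℕ} → (Fin n → Fin n → Subset n) → Set
Monotone R = ∀ u v p q → p ∈ R u v → q ∈ R u v → R p q ⊆ R u v

AxiomI : {n : ℕ} → (Fin n → Fin n → Subset n) → Set
AxiomI R = ∀ x y u v p q →
  Nonempty (R x y ∩ R u v) →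
  (R x y ∩ R u v) ⊆ R p q →
  Nonempty (R p q ─ (R x y ∪ R u v)) →
  (R x y ⊆ R p q) ⊎ (R u v ⊆ R p q)

AxiomO' : {n : ℕ} → (Fin n → Fin n → Subset n) → Set
AxiomO' R = ∀ u v z → z ∈ R u v →
  ∃ λ p → ∃ λ q → p ∈ R u v × q ∈ R u v × (R p z ∪ R z q) ≡ R u v

{-# OPTIONS --safe #-}
module Submission where

-- Fix z and write C x = R(x,z). Monotonicity makes s ∈ C x imply C s ⊆ C x, so
-- "s ∈ C x" is a preorder whose principal down-sets are the sets C x. Axiom (i),
-- applied to the intervals R(x,z), R(y,z), R(c,z) which all contain z, says that
-- any two elements incomparable with c have a common lower bound outside C c.
-- Hence an antichain x, y, w yields an antichain t, s, r of pairwise "private"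
-- lower bounds with C t ⊂ C x; descending on C x shows that there is no
-- antichain of size three.
-- For (o') start from p = u, q = v and keep u ∈ C p, v ∈ C q inside R(u,v).
-- A point w of R(u,v) outside C p ∪ C q is incomparable with p and q, which are
-- themselves incomparable, so w lies above p or q; replacing that endpoint by w
-- strictly enlarges C p ∪ C q, which must therefore eventually equal R(u,v).

open import Defs
open import Data.Nat using (ℕ; suc; _∸_; _<_)
open import Data.Nat.Induction using (<-wellFounded)
open import Data.Nat.Properties using (∸-monoʳ-<)
open import Data.Fin using (Fin)
open import Data.Fin.Properties using (any?)
open import Data.Fin.Subset using (Subset; _∈_; _∉_; _⊆_; _⊈_; _⊂_; _⊃_; _∩_; _∪_; ∣_∣)
open import Data.Fin.Subset.Properties
  using (_∈?_; _⊆?_; x∈p∩q⁺; x∈p∩q⁻; x∈p∪q⁺; x∈p∪q⁻; x∈p∧x∉q⇒x∈p─q; ⊆-antisym; p⊂q⇒∣p∣<∣q∣; ∣p∣≤n)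
open import Data.Product using (_×_; ∃; _,_)
open import Data.Sum using (_⊎_; inj₁; inj₂; [_,_])
open import Data.Empty using (⊥)
open import Function using (_∘_)
open import Induction.WellFounded using (WellFounded; Acc; acc; module Subrelation)
open import Relation.Binary.Construct.On using () renaming (wellFounded to on-wellFounded)
open import Relation.Nullary using (yes; no; contradiction)
open import Relation.Nullary.Decidable using (_×-dec_; ¬?; decidable-stable)
open import Relation.Binary.PropositionalEquality using (_≡_; subst)

⊈⇒∃∈∉ : ∀ {n} {p q : Subset n} → p ⊈ q → ∃ λ x → x ∈ p × x ∉ q
⊈⇒∃∈∉ {p = p} {q} p⊈q with any? (λ x → x ∈? p ×-dec ¬? (x ∈? q))
... | yes witness = witness
... | no ∄ = contradiction {A = p ⊆ q} p⊆q p⊈q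
  where
  p⊆q : p ⊆ q
  p⊆q {x} x∈p = decidable-stable (x ∈? q) (λ x∉q → ∄ (x , x∈p , x∉q))

∪-lub : ∀ {n} {p q r : Subset n} → p ⊆ r → q ⊆ r → p ∪ q ⊆ r
∪-lub {p = p} {q} p⊆r q⊆r x∈p∪q = [ p⊆r , q⊆r ] (x∈p∪q⁻ p q x∈p∪q)

∪-monoˡ-⊆ : ∀ {n} {p p′ : Subset n} (q : Subset n) → p ⊆ p′ → p ∪ q ⊆ p′ ∪ q
∪-monoˡ-⊆ q p⊆p′ = ∪-lub (x∈p∪q⁺ ∘ inj₁ ∘ p⊆p′) (x∈p∪q⁺ ∘ inj₂)

∪-monoʳ-⊆ : ∀ {n} (p : Subset n) {q q′ : Subset n} → q ⊆ q′ → p ∪ q ⊆ p ∪ q′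
∪-monoʳ-⊆ p q⊆q′ = ∪-lub (x∈p∪q⁺ ∘ inj₁) (x∈p∪q⁺ ∘ inj₂ ∘ q⊆q′)

⊂-wellFounded : ∀ {n} → WellFounded (_⊂_ {n})
⊂-wellFounded = Subrelation.wellFounded p⊂q⇒∣p∣<∣q∣ (on-wellFounded ∣_∣ <-wellFounded)

⊃-wellFounded : ∀ {n} → WellFounded (_⊃_ {n})
⊃-wellFounded {n} = Subrelation.wellFounded co-size-decreases
  (on-wellFounded (λ p → n ∸ ∣ p ∣) <-wellFounded)
  where
  co-size-decreases : ∀ {p q : Subset n} → q ⊂ p → n ∸ ∣ p ∣ < n ∸ ∣ q ∣
  co-size-decreases {p} q⊂p = ∸-monoʳ-< (p⊂q⇒∣p∣<∣q∣ q⊂p) (∣p∣≤n p)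

module Cones {n : ℕ} {R : Fin n → Fin n → Subset n}
             (transit : IsTransit R) (monotone : Monotone R) (axiomI : AxiomI R) (z : Fin n) where
  open IsTransit transit

  C : Fin n → Subset n
  C x = R x z

  x∈C : ∀ x → x ∈ C x
  x∈C x = extensive x z

  z∈C : ∀ x → z ∈ C x
  z∈C x = subst (z ∈_) (symmetric z x) (extensive z x)

  C-mono : ∀ {s x} → s ∈ C x → C s ⊆ C x
  C-mono {s} {x} s∈Cx = monotone x z s z s∈Cx (z∈C x)

  ∉C-anti : ∀ {s x y} → s ∈ C x → y ∉ C x → y ∉ C s
  ∉C-anti s∈Cx y∉Cx = y∉Cx ∘ C-mono s∈Cx

  _∥_ : Fin n → Fin n → Set
  x ∥ y = x ∉ C y × y ∉ C x

  ∥-sym : ∀ {x y} → x ∥ y → y ∥ x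
  ∥-sym (x∉Cy , y∉Cx) = y∉Cx , x∉Cy

  ∃-private-lower-bound : ∀ {x y c} → x ∥ c → y ∥ c → ∃ λ t → t ∈ C x × t ∈ C y × t ∉ C c
  ∃-private-lower-bound {x} {y} {c} (x∉Cc , c∉Cx) (y∉Cc , c∉Cy) with C x ∩ C y ⊆? C c
  ... | no Cx∩Cy⊈Cc with ⊈⇒∃∈∉ Cx∩Cy⊈Cc
  ...   | t , t∈Cx∩Cy , t∉Cc with x∈p∩q⁻ (C x) (C y) t∈Cx∩Cy
  ...     | t∈Cx , t∈Cy = t , t∈Cx , t∈Cy , t∉Cc
  ∃-private-lower-bound {x} {y} {c} (x∉Cc , c∉Cx) (y∉Cc , c∉Cy) | yes Cx∩Cy⊆Cc
    with axiomI x z y z c z (z , x∈p∩q⁺ (z∈C x , z∈C y)) Cx∩Cy⊆Cc (c , c∈Cc─[Cx∪Cy])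
    where
    c∈Cc─[Cx∪Cy] = x∈p∧x∉q⇒x∈p─q (x∈C c) ([ c∉Cx , c∉Cy ] ∘ x∈p∪q⁻ (C x) (C y))
  ... | inj₁ Cx⊆Cc = contradiction (Cx⊆Cc (x∈C x)) x∉Cc
  ... | inj₂ Cy⊆Cc = contradiction (Cy⊆Cc (x∈C y)) y∉Cc

  no-antichain₃ : ∀ {x y w} → x ∥ y → x ∥ w → y ∥ w → ⊥
  no-antichain₃ {x} = go (⊂-wellFounded (C x))
    where
    go : ∀ {x y w} → Acc _⊂_ (C x) → x ∥ y → x ∥ w → y ∥ w → ⊥
    go {x} {y} {w} (acc smaller) x∥y@(x∉Cy , _) x∥w y∥w
      with ∃-private-lower-bound x∥w y∥w
         | ∃-private-lower-bound x∥y (∥-sym y∥w)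
         | ∃-private-lower-bound (∥-sym x∥y) (∥-sym x∥w)
    ... | t , t∈Cx , t∈Cy , t∉Cw | s , s∈Cx , s∈Cw , s∉Cy | r , r∈Cy , r∈Cw , r∉Cx =
      go (smaller Ct⊂Cx)
         (∉C-anti s∈Cw t∉Cw , ∉C-anti t∈Cy s∉Cy)
         (∉C-anti r∈Cw t∉Cw , ∉C-anti t∈Cx r∉Cx)
         (∉C-anti r∈Cy s∉Cy , ∉C-anti s∈Cx r∉Cx)
      where
      Ct⊂Cx : C t ⊂ C x
      Ct⊂Cx = C-mono t∈Cx , x , x∈C x , ∉C-anti t∈Cy x∉Cy

  above-an-endpoint : ∀ {p q w} → p ∥ q → w ∉ C p → w ∉ C q → p ∈ C w ⊎ q ∈ C w
  above-an-endpoint {p} {q} {w} p∥q w∉Cp w∉Cq with p ∈? C w | q ∈? C w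
  ... | yes p∈Cw | _        = inj₁ p∈Cw
  ... | no _     | yes q∈Cw = inj₂ q∈Cw
  ... | no p∉Cw  | no q∉Cw  = contradiction (p∉Cw , w∉Cp) (λ p∥w → no-antichain₃ p∥q p∥w (q∉Cw , w∉Cq))

  module Covering (u v : Fin n) (z∈T : z ∈ R u v) where
    T : Subset n
    T = R u v

    C⊆T : ∀ {p} → p ∈ T → C p ⊆ T
    C⊆T p∈T = monotone u v _ z p∈T z∈T

    T⊆C : ∀ {q} → u ∈ C q → v ∈ C q → T ⊆ C q
    T⊆C u∈Cq v∈Cq = monotone _ z u v u∈Cq v∈Cq

    record Bracket : Set where
      constructor bracket
      field
        {left right} : Fin n
        left∈T : left ∈ T
        right∈T : right ∈ T
        u∈Cleft : u ∈ C left
        v∈Cright : v ∈ C right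

    span : Bracket → Subset n
    span b = C left ∪ C right where open Bracket b

    grow : ∀ b → T ⊈ span b → ∃ λ b′ → span b ⊂ span b′
    grow b@(bracket {p} {q} p∈T q∈T u∈Cp v∈Cq) T⊈span with ⊈⇒∃∈∉ T⊈span
    ... | w , w∈T , w∉span with above-an-endpoint p∥q w∉Cp w∉Cq
      where
      w∉Cp : w ∉ C p
      w∉Cp = w∉span ∘ x∈p∪q⁺ ∘ inj₁
      w∉Cq : w ∉ C q
      w∉Cq = w∉span ∘ x∈p∪q⁺ ∘ inj₂
      p∥q : p ∥ q
      p∥q = (λ p∈Cq → w∉Cq (T⊆C (C-mono p∈Cq u∈Cp) v∈Cq w∈T))
          , (λ q∈Cp → w∉Cp (T⊆C u∈Cp (C-mono q∈Cp v∈Cq) w∈T))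
    ... | inj₁ p∈Cw = bracket w∈T q∈T (C-mono p∈Cw u∈Cp) v∈Cq
                    , ∪-monoˡ-⊆ (C q) (C-mono p∈Cw) , w , x∈p∪q⁺ (inj₁ (x∈C w)) , w∉span
    ... | inj₂ q∈Cw = bracket p∈T w∈T u∈Cp (C-mono q∈Cw v∈Cq)
                    , ∪-monoʳ-⊆ (C p) (C-mono q∈Cw) , w , x∈p∪q⁺ (inj₂ (x∈C w)) , w∉span

    span-reaches-T : ∀ b → Acc _⊃_ (span b) → ∃ λ b′ → span b′ ≡ T
    span-reaches-T b (acc larger) with T ⊆? span b
    ... | yes T⊆span = b , ⊆-antisym (∪-lub (C⊆T left∈T) (C⊆T right∈T)) T⊆span
      where open Bracket b
    ... | no T⊈span with grow b T⊈span
    ...   | b′ , span⊂span′ = span-reaches-T b′ (larger span⊂span′)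

    T≡C∪C : ∃ λ p → ∃ λ q → p ∈ T × q ∈ T × C p ∪ C q ≡ T
    T≡C∪C with span-reaches-T initial (⊃-wellFounded _)
      where
      initial : Bracket
      initial = bracket (extensive u v) (subst (v ∈_) (symmetric v u) (extensive v u)) (x∈C u) (x∈C v)
    ... | bracket p∈T q∈T _ _ , span≡T = _ , _ , p∈T , q∈T , span≡T

mainTheorem9 : (m : ℕ) (R : Fin (suc m) → Fin (suc m) → Subset (suc m)) →
    IsTransit R → Monotone R → AxiomI R → AxiomO' R
mainTheorem9 m R transit monotone axiomI u v z z∈Ruv with Covering.T≡C∪C u v z∈Ruv
  where open Cones transit monotone axiomI z
... | p , q , p∈Ruv , q∈Ruv , Rpz∪Rqz≡Ruv =
  p , q , p∈Ruv , q∈Ruv , subst (λ S → R p z ∪ S ≡ R u v) (IsTransit.symmetric transit q z) Rpz∪Rqz≡Ruv
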